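{- Let $k$ be a nonnegative integer, let $h \geq 2$ be an integer, and let $m = 2^{\lfloor \log_2 h \rfloor}(4k+3)$. Then \[\sum_{i=0}^{h} \binom{m-1}{i-1} \equiv 0 \pmod 2 \quad\text{and}\quad \sum_{i=0}^{h}\binom{m}{i} \equiv 2 \pmod 4.\]
   Context: $\lfloor x \rfloor$ is the greatest integer $\le x$. For integers $n,r$, $\binom{n}{r} = \frac{n!}{r!(n-r)!}$ if $0 \le r \le n$ and $\binom{n}{r} = 0$ if $r > n$ or $r < 0$ (so the $i=0$ term of the first sum is $0$). -}

module Defs where

open import Data.Nat using (ℕ; zero; suc; _+_; _∸_)
open import Data.Nat.Combinatorics using (_C_)

sumTo : ℕ → (ℕ → ℕ) → ℕ
sumTo zero    f = f 0
sumTo (suc h) f = sumTo h f + f (suc h)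

-- binom n (i - 1) with the paper's convention: zero when i - 1 < 0, i.e. i = 0
binomPred : ℕ → ℕ → ℕ
binomPred n zero    = 0
binomPred n (suc i) = n C i

-- Let n = m - 1. In C(n, j+1) = C(n, j) (n - j)/(j + 1) the factor (n - j)/(j + 1)
-- = (m - (j+1))/(j+1) has 2-adic valuation 0 for every j + 1 < 2^(a+1) except
-- j + 1 = 2^a, where m - 2^a = 2^(a+1) (2k + 1) contributes exactly one factor 2.
-- Hence C(n, j) is odd for j < 2^a and twice an odd number for 2^a ≤ j ≤ h.
-- Pascal's rule gives Σ_{i≤h} C(m, i) = 2 Σ_{i<h} C(n, i) + C(n, h), and once more
-- Σ_{i<h} C(n, i) = 2 Σ_{i<h-1} C(n-1, i) + C(n-1, h-1), whose last term is even
-- because h C(n, h) = n C(n-1, h-1) with n odd. So the first sum is even and the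
-- second is 4w + 2·odd.
module Submission where

open import Defs
open import Data.Nat using (ℕ; _+_; _*_; _∸_; _^_; _≤_; _%_)
open import Data.Nat.Logarithm using (⌊log₂_⌋)
open import Data.Nat.Combinatorics using (_C_)
open import Data.Product using (_×_)
open import Relation.Binary.PropositionalEquality using (_≡_)

open import Data.Nat.Base
  using (zero; suc; _<_; z≤n; s≤s; NonZero; >-nonZero; _!; ⌊_/2⌋; ⌈_/2⌉)
open import Data.Nat.Properties
open import Data.Nat.DivMod using (m/n*n≡m; [m+kn]%n≡m%n; m*n%n≡0)
open import Data.Nat.Combinatorics
  using ( nCk≡n!/k![n-k]!; k![n∸k]!∣n!; nCk+nC[k+1]≡[n+1]C[k+1]; nC1≡n
        ; [n-k]*[n-k-1]!≡[n-k]!)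
open import Data.Nat.Logarithm using (⌊log₂⌋-mono-≤; ⌊log₂[2^n]⌋≡n)
open import Data.Nat.Logarithm.Core using (⌊log2⌋)
open import Data.Nat.Induction using (<-wellFounded)
open import Data.Nat.Tactic.RingSolver using (solve-∀)
open import Induction.WellFounded using (Acc; acc)
open import Data.Product using (_,_; ∃-syntax)
open import Data.Sum using (_⊎_; inj₁; inj₂)
open import Data.Empty using (⊥-elim)
open import Relation.Nullary using (yes; no)
open import Relation.Binary using (tri<; tri≈; tri>)
open import Relation.Binary.PropositionalEquality
  using (refl; sym; trans; cong; cong₂; subst; subst₂; _≢_; ≢-sym)

open ≤-Reasoning

even⊎odd : ∀ n → (∃[ r ] n ≡ 2 * r) ⊎ (∃[ r ] n ≡ suc (2 * r))
even⊎odd zero = inj₁ (0 , refl)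
even⊎odd (suc n) with even⊎odd n
... | inj₁ (r , refl) = inj₂ (r , refl)
... | inj₂ (r , refl) = inj₁ (suc r , sym (*-distribˡ-+ 2 1 r))

odd*odd : ∀ r t → suc (2 * r) * suc (2 * t) ≡ suc (2 * (r + t + 2 * r * t))
odd*odd = solve-∀

odd*odd≢even : ∀ r t w → suc (2 * r) * suc (2 * t) ≢ 2 * w
odd*odd≢even r t w eq = even≢odd w (r + t + 2 * r * t) (trans (sym eq) (odd*odd r t))

record Val₂ (x e : ℕ) : Set where
  constructor val₂
  field
    oddPart : ℕ
    decomposition : x ≡ 2 ^ e * suc (2 * oddPart)

Val₂-2^ : ∀ e → Val₂ (2 ^ e) e
Val₂-2^ e = val₂ 0 (sym (*-identityʳ (2 ^ e)))

Val₂-double : ∀ {x e} → Val₂ x e → Val₂ (2 * x) (suc e)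
Val₂-double {e = e} (val₂ t refl) = val₂ t (sym (*-assoc 2 (2 ^ e) (suc (2 * t))))

Val₂-* : ∀ {x y e f} → Val₂ x e → Val₂ y f → Val₂ (x * y) (e + f)
Val₂-* {e = e} {f} (val₂ t refl) (val₂ s refl) = val₂ (t + s + 2 * t * s) (begin-equality
  2 ^ e * suc (2 * t) * (2 ^ f * suc (2 * s))
    ≡⟨ interchange (2 ^ e) (suc (2 * t)) (2 ^ f) (suc (2 * s)) ⟩
  2 ^ e * 2 ^ f * (suc (2 * t) * suc (2 * s))
    ≡⟨ cong₂ _*_ (sym (^-distribˡ-+-* 2 e f)) (odd*odd t s) ⟩
  2 ^ (e + f) * suc (2 * (t + s + 2 * t * s)) ∎)
  where
  interchange : ∀ a b c d → a * b * (c * d) ≡ a * c * (b * d)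
  interchange = solve-∀

Val₂-cancelʳ-odd : ∀ e y t s → y * suc (2 * t) ≡ 2 ^ e * suc (2 * s) → Val₂ y e
Val₂-cancelʳ-odd e y t s eq with even⊎odd y
Val₂-cancelʳ-odd zero _ t s eq | inj₁ (r , refl) =
  ⊥-elim (even≢odd (r * suc (2 * t)) s
    (trans (sym (*-assoc 2 r (suc (2 * t)))) (trans eq (*-identityˡ (suc (2 * s))))))
Val₂-cancelʳ-odd zero _ t s eq | inj₂ (r , refl) = val₂ r (sym (*-identityˡ _))
Val₂-cancelʳ-odd (suc e) _ t s eq | inj₁ (r , refl) =
  Val₂-double (Val₂-cancelʳ-odd e r t s (*-cancelˡ-≡ _ _ 2
    (trans (sym (*-assoc 2 r (suc (2 * t)))) (trans eq (*-assoc 2 (2 ^ e) (suc (2 * s)))))))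
Val₂-cancelʳ-odd (suc e) _ t s eq | inj₂ (r , refl) =
  ⊥-elim (odd*odd≢even r t (2 ^ e * suc (2 * s)) (trans eq (*-assoc 2 (2 ^ e) (suc (2 * s)))))

Val₂-cancelʳ : ∀ {x y e g} → Val₂ x g → Val₂ (y * x) (e + g) → Val₂ y e
Val₂-cancelʳ {y = y} {e} {g} (val₂ t refl) (val₂ s eq) =
  Val₂-cancelʳ-odd e y t s (*-cancelˡ-≡ _ _ (2 ^ g) {{m^n≢0 2 g}} (begin-equality
    2 ^ g * (y * suc (2 * t))       ≡⟨ x∙yz≈y∙xz (2 ^ g) y _ ⟩
    y * (2 ^ g * suc (2 * t))       ≡⟨ eq ⟩
    2 ^ (e + g) * suc (2 * s)       ≡⟨ cong (_* suc (2 * s)) (^-distribˡ-+-* 2 e g) ⟩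
    2 ^ e * 2 ^ g * suc (2 * s)     ≡⟨ cong (_* suc (2 * s)) (*-comm (2 ^ e) (2 ^ g)) ⟩
    2 ^ g * 2 ^ e * suc (2 * s)     ≡⟨ *-assoc (2 ^ g) (2 ^ e) _ ⟩
    2 ^ g * (2 ^ e * suc (2 * s))   ∎))
  where
  open import Algebra.Properties.CommutativeSemigroup *-commutativeSemigroup using (x∙yz≈y∙xz)

Val₂-exists : ∀ x .{{_ : NonZero x}} → ∃[ e ] Val₂ x e
Val₂-exists x = go x (<-wellFounded x)
  where
  go : ∀ x → Acc _<_ x → .{{NonZero x}} → ∃[ e ] Val₂ x e
  go x (acc rec) with even⊎odd x
  ... | inj₂ (r , refl) = 0 , val₂ r (sym (*-identityˡ _))
  ... | inj₁ (suc r , refl) with go (suc r) (rec (m<m+n (suc r) (s≤s z≤n)))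
  ...   | e , v = suc e , Val₂-double v

Val₂-bound : ∀ {i g} a → Val₂ i g → i < 2 ^ suc a → i ≢ 2 ^ a → g < a
Val₂-bound {g = g} a (val₂ t eq) i<2P i≢P with <-cmp g a
... | tri< g<a _ _ = g<a
Val₂-bound a (val₂ zero eq) i<2P i≢P | tri≈ _ refl _ =
  ⊥-elim (i≢P (trans eq (*-identityʳ (2 ^ a))))
Val₂-bound a (val₂ (suc t) eq) i<2P i≢P | tri≈ _ refl _ =
  ⊥-elim (<⇒≱ i<2P (begin
    2 ^ suc a                    ≡⟨ *-comm 2 (2 ^ a) ⟩
    2 ^ a * 2                    ≤⟨ *-monoʳ-≤ (2 ^ a) (s≤s (s≤s z≤n)) ⟩
    2 ^ a * suc (2 * suc t)      ≡⟨ eq ⟨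
    _                            ∎))
... | tri> _ _ a<g = ⊥-elim (<⇒≱ i<2P (begin
  2 ^ suc a                    ≤⟨ ^-monoʳ-≤ 2 a<g ⟩
  2 ^ g                        ≤⟨ m≤m*n (2 ^ g) (suc (2 * t)) ⟩
  _                            ≡⟨ eq ⟨
  _                            ∎))

Val₂-∸ : ∀ {i g} w → Val₂ i g → i < 2 ^ g * (2 * w) → Val₂ (2 ^ g * (2 * w) ∸ i) g
Val₂-∸ {g = g} w (val₂ t refl) i<M with m≤n⇒∃[o]m+o≡n t<w
  where
  t<w : suc t ≤ w
  t<w = *-cancelˡ-≤ 2 (≤-trans (≤-reflexive (*-distribˡ-+ 2 1 t))
          (*-cancelˡ-< (2 ^ g) (suc (2 * t)) (2 * w) i<M))
... | s , refl = val₂ s (begin-equality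
  2 ^ g * (2 * (suc t + s)) ∸ 2 ^ g * suc (2 * t)
    ≡⟨ cong (_∸ 2 ^ g * suc (2 * t)) (split (2 ^ g) t s) ⟩
  2 ^ g * suc (2 * s) + 2 ^ g * suc (2 * t) ∸ 2 ^ g * suc (2 * t)
    ≡⟨ m+n∸n≡m (2 ^ g * suc (2 * s)) (2 ^ g * suc (2 * t)) ⟩
  2 ^ g * suc (2 * s) ∎)
  where
  split : ∀ P t s → P * (2 * (suc t + s)) ≡ P * suc (2 * s) + P * suc (2 * t)
  split = solve-∀

Val₂-2^a*q∸ : ∀ {i g a} q → Val₂ i g → g < a → i < 2 ^ a * q → Val₂ (2 ^ a * q ∸ i) g
Val₂-2^a*q∸ {i} {g} q vi g<a i<m with m≤n⇒∃[o]m+o≡n g<a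
... | d , refl = subst (λ M → Val₂ (M ∸ i) g) (sym 2^[1+g+d]q)
                   (Val₂-∸ (2 ^ d * q) vi (subst (i <_) 2^[1+g+d]q i<m))
  where
  regroup : ∀ A B q → 2 * (A * B) * q ≡ A * (2 * (B * q))
  regroup = solve-∀
  2^[1+g+d]q : 2 ^ suc (g + d) * q ≡ 2 ^ g * (2 * (2 ^ d * q))
  2^[1+g+d]q = trans (cong (λ z → 2 * z * q) (^-distribˡ-+-* 2 g d)) (regroup (2 ^ g) (2 ^ d) q)

Val₂-2^a[4k+3]∸2^a : ∀ a k → Val₂ (2 ^ a * (4 * k + 3) ∸ 2 ^ a) (suc a)
Val₂-2^a[4k+3]∸2^a a k = val₂ k (begin-equality
  2 ^ a * (4 * k + 3) ∸ 2 ^ a                 ≡⟨ cong (_∸ 2 ^ a) (split (2 ^ a) k) ⟩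
  2 * 2 ^ a * suc (2 * k) + 2 ^ a ∸ 2 ^ a     ≡⟨ m+n∸n≡m _ (2 ^ a) ⟩
  2 ^ suc a * suc (2 * k)                     ∎)
  where
  split : ∀ P k → P * (4 * k + 3) ≡ 2 * P * suc (2 * k) + P
  split = solve-∀

nCk*k![n∸k]!≡n! : ∀ {n k} → k ≤ n → (n C k) * (k ! * (n ∸ k) !) ≡ n !
nCk*k![n∸k]!≡n! {n} {k} k≤n = trans (cong (_* (k ! * (n ∸ k) !)) (nCk≡n!/k![n-k]! k≤n))
  (m/n*n≡m {{k !* (n ∸ k) !≢0}} (k![n∸k]!∣n! k≤n))

nC[1+k]*[1+k]≡nCk*[n∸k] : ∀ {n k} → k < n → (n C suc k) * suc k ≡ (n C k) * (n ∸ k)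
nC[1+k]*[1+k]≡nCk*[n∸k] {n} {k} k<n =
  *-cancelʳ-≡ _ _ (k ! * (n ∸ suc k) !) {{k !* (n ∸ suc k) !≢0}} (begin-equality
    (n C suc k) * suc k * (k ! * (n ∸ suc k) !)
      ≡⟨ regroupˡ (n C suc k) (suc k) (k !) ((n ∸ suc k) !) ⟩
    (n C suc k) * (suc k * k ! * (n ∸ suc k) !)
      ≡⟨ nCk*k![n∸k]!≡n! k<n ⟩
    n !
      ≡⟨ nCk*k![n∸k]!≡n! (<⇒≤ k<n) ⟨
    (n C k) * (k ! * (n ∸ k) !)
      ≡⟨ cong (λ z → (n C k) * (k ! * z)) ([n-k]*[n-k-1]!≡[n-k]! k<n) ⟨
    (n C k) * (k ! * ((n ∸ k) * (n ∸ suc k) !))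
      ≡⟨ regroupʳ (n C k) (k !) (n ∸ k) ((n ∸ suc k) !) ⟩
    (n C k) * (n ∸ k) * (k ! * (n ∸ suc k) !) ∎)
  where
  regroupˡ : ∀ c s f r → c * s * (f * r) ≡ c * (s * f * r)
  regroupˡ = solve-∀
  regroupʳ : ∀ c f d r → c * (f * (d * r)) ≡ c * d * (f * r)
  regroupʳ = solve-∀

[1+k]*[1+n]C[1+k]≡[1+n]*nCk : ∀ {n k} → k < n → suc k * (suc n C suc k) ≡ suc n * (n C k)
[1+k]*[1+n]C[1+k]≡[1+n]*nCk {n} {k} k<n = begin-equality
  suc k * (suc n C suc k)
    ≡⟨ cong (suc k *_) (nCk+nC[k+1]≡[n+1]C[k+1] n k) ⟨
  suc k * (n C k + n C suc k)
    ≡⟨ *-distribˡ-+ (suc k) (n C k) (n C suc k) ⟩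
  suc k * (n C k) + suc k * (n C suc k)
    ≡⟨ cong₂ _+_ (*-comm (suc k) (n C k))
                 (trans (*-comm (suc k) (n C suc k)) (nC[1+k]*[1+k]≡nCk*[n∸k] k<n)) ⟩
  (n C k) * suc k + (n C k) * (n ∸ k)
    ≡⟨ *-distribˡ-+ (n C k) (suc k) (n ∸ k) ⟨
  (n C k) * suc (k + (n ∸ k))
    ≡⟨ cong (λ z → (n C k) * suc z) (m+[n∸m]≡n (<⇒≤ k<n)) ⟩
  (n C k) * suc n
    ≡⟨ *-comm (n C k) (suc n) ⟩
  suc n * (n C k) ∎

Val₂-nC[1+j] : ∀ {n j e g} d → j < n → Val₂ (n C j) e → Val₂ (suc j) g →
               Val₂ (n ∸ j) (d + g) → Val₂ (n C suc j) (e + d)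
Val₂-nC[1+j] {e = e} {g} d j<n vC vj vn∸j = Val₂-cancelʳ vj
  (subst₂ Val₂ (sym (nC[1+k]*[1+k]≡nCk*[n∸k] j<n)) (sym (+-assoc e d g)) (Val₂-* vC vn∸j))

module BinomialRow (a k : ℕ) where

  m n : ℕ
  m = 2 ^ a * (4 * k + 3)
  n = m ∸ 1

  2^[1+a]<m : 2 ^ suc a < m
  2^[1+a]<m = begin-strict
    2 ^ suc a              <⟨ m<m+n (2 ^ suc a) (m^n>0 2 a) ⟩
    2 ^ suc a + 2 ^ a      ≡⟨ triple (2 ^ a) ⟩
    2 ^ a * 3              ≤⟨ *-monoʳ-≤ (2 ^ a) (m≤n+m 3 (4 * k)) ⟩
    m                      ∎
    where
    triple : ∀ P → 2 * P + P ≡ P * 3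
    triple = solve-∀

  2^[1+a]≤n : 2 ^ suc a ≤ n
  2^[1+a]≤n = ∸-monoˡ-≤ 1 2^[1+a]<m

  Val₂-nC-step : ∀ {j e} → suc j < 2 ^ suc a → suc j ≢ 2 ^ a →
                 Val₂ (n C j) e → Val₂ (n C suc j) e
  Val₂-nC-step {j} {e} 1+j<2P 1+j≢P vC with Val₂-exists (suc j)
  ... | g , vj = subst (Val₂ (n C suc j)) (+-identityʳ e) (Val₂-nC[1+j] 0 j<n vC vj vn∸j)
    where
    j<n : j < n
    j<n = <-≤-trans (<-trans (n<1+n j) 1+j<2P) 2^[1+a]≤n
    vn∸j : Val₂ (n ∸ j) g
    vn∸j = subst (λ x → Val₂ x g) (sym (∸-+-assoc m 1 j))
      (Val₂-2^a*q∸ (4 * k + 3) vj (Val₂-bound a vj 1+j<2P 1+j≢P) (<-trans 1+j<2P 2^[1+a]<m))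

  nCj-odd : ∀ j → j < 2 ^ a → Val₂ (n C j) 0
  nCj-odd zero _ = val₂ 0 refl
  nCj-odd (suc j) 1+j<P =
    Val₂-nC-step (<-trans 1+j<P 2^a<2^[1+a]) (<⇒≢ 1+j<P) (nCj-odd j (<-trans (n<1+n j) 1+j<P))
    where
    2^a<2^[1+a] : 2 ^ a < 2 ^ suc a
    2^a<2^[1+a] = ^-monoʳ-< 2 (s≤s (s≤s z≤n)) (n<1+n a)

  nCj-twice-odd : ∀ j → 2 ^ a ≤ j → j < 2 ^ suc a → Val₂ (n C j) 1
  nCj-twice-odd zero P≤0 _ = ⊥-elim (<⇒≱ (m^n>0 2 a) P≤0)
  nCj-twice-odd (suc j) P≤1+j 1+j<2P with m≤n⇒m<n∨m≡n P≤1+j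
  ... | inj₁ P<1+j = Val₂-nC-step 1+j<2P (≢-sym (<⇒≢ P<1+j))
                       (nCj-twice-odd j (≤-pred P<1+j) (<-trans (n<1+n j) 1+j<2P))
  ... | inj₂ P≡1+j = Val₂-nC[1+j] 1 j<n (nCj-odd j (subst (j <_) (sym P≡1+j) (n<1+n j)))
                       (subst (λ x → Val₂ x a) P≡1+j (Val₂-2^ a))
                       (subst (λ x → Val₂ x (suc a)) m∸2^a≡n∸j (Val₂-2^a[4k+3]∸2^a a k))
    where
    j<n : j < n
    j<n = <-≤-trans (<-trans (n<1+n j) 1+j<2P) 2^[1+a]≤n
    m∸2^a≡n∸j : m ∸ 2 ^ a ≡ n ∸ j
    m∸2^a≡n∸j = trans (cong (m ∸_) P≡1+j) (sym (∸-+-assoc m 1 j))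

sumTo-binomPred : ∀ n t → sumTo (suc t) (binomPred n) ≡ sumTo t (n C_)
sumTo-binomPred n zero = refl
sumTo-binomPred n (suc t) = cong (_+ n C suc t) (sumTo-binomPred n t)

sumTo-pascal : ∀ n t → sumTo (suc t) (suc n C_) ≡ 2 * sumTo t (n C_) + n C suc t
sumTo-pascal n zero = cong (λ z → 1 + z) (trans (nC1≡n (suc n)) (cong suc (sym (nC1≡n n))))
sumTo-pascal n (suc t) = begin-equality
  sumTo (suc t) (suc n C_) + suc n C suc (suc t)
    ≡⟨ cong₂ _+_ (sumTo-pascal n t) (sym (nCk+nC[k+1]≡[n+1]C[k+1] n (suc t))) ⟩
  2 * sumTo t (n C_) + n C suc t + (n C suc t + n C suc (suc t))
    ≡⟨ regroup (sumTo t (n C_)) (n C suc t) (n C suc (suc t)) ⟩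
  2 * (sumTo t (n C_) + n C suc t) + n C suc (suc t) ∎
  where
  regroup : ∀ a b c → 2 * a + b + (b + c) ≡ 2 * (a + b) + c
  regroup = solve-∀

[2u]C[1+t]-even : ∀ u t → suc t < 2 * u → Val₂ (suc (2 * u) C suc (suc t)) 1 →
                  ∃[ w ] 2 * u C suc t ≡ 2 * w
[2u]C[1+t]-even u t 1+t<2u (val₂ s eq) with even⊎odd (2 * u C suc t)
... | inj₁ even = even
... | inj₂ (r , odd) = ⊥-elim (odd*odd≢even u r (suc (suc t) * suc (2 * s)) (begin-equality
  suc (2 * u) * suc (2 * r)                  ≡⟨ cong (suc (2 * u) *_) odd ⟨
  suc (2 * u) * (2 * u C suc t)              ≡⟨ [1+k]*[1+n]C[1+k]≡[1+n]*nCk 1+t<2u ⟨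
  suc (suc t) * (suc (2 * u) C suc (suc t))  ≡⟨ cong (suc (suc t) *_) eq ⟩
  suc (suc t) * (2 * 1 * suc (2 * s))        ≡⟨ swap (suc (suc t)) (suc (2 * s)) ⟩
  2 * (suc (suc t) * suc (2 * s))            ∎))
  where
  swap : ∀ h o → h * (2 * 1 * o) ≡ 2 * (h * o)
  swap = solve-∀

binomial-sums : ∀ m u h → m ≡ suc (suc (2 * u)) → 2 ≤ h → h < m ∸ 1 →
                Val₂ ((m ∸ 1) C h) 1 →
                sumTo h (binomPred (m ∸ 1)) % 2 ≡ 0 × sumTo h (m C_) % 4 ≡ 2
binomial-sums _ u (suc (suc t)) refl (s≤s (s≤s z≤n)) h<n v@(val₂ s nCh≡2o)
  with [2u]C[1+t]-even u t (≤-pred h<n) v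
... | w , [2u]C[1+t]≡2w = even-sum , twice-odd-sum
  where
  n = suc (2 * u)
  w′ = sumTo t (2 * u C_) + w
  S≡2w′ : sumTo (suc t) (n C_) ≡ 2 * w′
  S≡2w′ = begin-equality
    sumTo (suc t) (n C_)                    ≡⟨ sumTo-pascal (2 * u) t ⟩
    2 * sumTo t (2 * u C_) + 2 * u C suc t  ≡⟨ cong (2 * sumTo t (2 * u C_) +_) [2u]C[1+t]≡2w ⟩
    2 * sumTo t (2 * u C_) + 2 * w          ≡⟨ *-distribˡ-+ 2 (sumTo t (2 * u C_)) w ⟨
    2 * w′                                  ∎
  even-sum : sumTo (suc (suc t)) (binomPred n) % 2 ≡ 0
  even-sum = trans (cong (_% 2) (trans (sumTo-binomPred n (suc t)) (trans S≡2w′ (*-comm 2 w′))))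
                   (m*n%n≡0 w′ 2)
  twice-odd-sum : sumTo (suc (suc t)) (suc n C_) % 4 ≡ 2
  twice-odd-sum = trans (cong (_% 4) (begin-equality
    sumTo (suc (suc t)) (suc n C_)              ≡⟨ sumTo-pascal n (suc t) ⟩
    2 * sumTo (suc t) (n C_) + n C suc (suc t)  ≡⟨ cong₂ (λ x y → 2 * x + y) S≡2w′ nCh≡2o ⟩
    2 * (2 * w′) + 2 * 1 * suc (2 * s)          ≡⟨ collect w′ s ⟩
    2 + (w′ + s) * 4                            ∎)) ([m+kn]%n≡m%n 2 (w′ + s) 4)
    where
    collect : ∀ w s → 2 * (2 * w) + 2 * 1 * suc (2 * s) ≡ 2 + (w + s) * 4
    collect = solve-∀

2^⌊log₂n⌋≤n : ∀ n .{{_ : NonZero n}} → 2 ^ ⌊log₂ n ⌋ ≤ n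
2^⌊log₂n⌋≤n n = go n (<-wellFounded n)
  where
  go : ∀ n (rs : Acc _<_ n) .{{_ : NonZero n}} → 2 ^ ⌊log2⌋ n rs ≤ n
  go 1 _ = ≤-refl
  go (suc (suc n)) (acc rs) = begin
    2 * 2 ^ ⌊log2⌋ (suc ⌊ n /2⌋) _  ≤⟨ *-monoʳ-≤ 2 (go (suc ⌊ n /2⌋) (rs (⌊n/2⌋<n (suc n)))) ⟩
    2 * suc ⌊ n /2⌋                 ≡⟨ *-distribˡ-+ 2 1 ⌊ n /2⌋ ⟩
    2 + 2 * ⌊ n /2⌋                 ≡⟨ cong (λ z → 2 + (⌊ n /2⌋ + z)) (+-identityʳ ⌊ n /2⌋) ⟩
    2 + (⌊ n /2⌋ + ⌊ n /2⌋)         ≤⟨ +-monoʳ-≤ 2 (+-monoʳ-≤ ⌊ n /2⌋ (⌊n/2⌋≤⌈n/2⌉ n)) ⟩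
    2 + (⌊ n /2⌋ + ⌈ n /2⌉)         ≡⟨ cong (2 +_) (⌊n/2⌋+⌈n/2⌉≡n n) ⟩
    2 + n                           ∎

n<2^[1+⌊log₂n⌋] : ∀ n → n < 2 ^ suc ⌊log₂ n ⌋
n<2^[1+⌊log₂n⌋] n with 2 ^ suc ⌊log₂ n ⌋ ≤? n
... | no 2^[1+⌊log₂n⌋]≰n = ≰⇒> 2^[1+⌊log₂n⌋]≰n
... | yes 2^[1+⌊log₂n⌋]≤n = ⊥-elim (n≮n ⌊log₂ n ⌋ (begin-strict
  ⌊log₂ n ⌋                   <⟨ n<1+n ⌊log₂ n ⌋ ⟩
  suc ⌊log₂ n ⌋               ≡⟨ ⌊log₂[2^n]⌋≡n (suc ⌊log₂ n ⌋) ⟨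
  ⌊log₂ 2 ^ suc ⌊log₂ n ⌋ ⌋   ≤⟨ ⌊log₂⌋-mono-≤ 2^[1+⌊log₂n⌋]≤n ⟩
  ⌊log₂ n ⌋                   ∎))

2^a*q≡2+2u : ∀ a q → 1 ≤ a → 0 < q → ∃[ u ] 2 ^ a * q ≡ suc (suc (2 * u))
2^a*q≡2+2u (suc a) q _ 0<q with m≤n⇒∃[o]m+o≡n (*-mono-≤ (m^n>0 2 a) 0<q)
... | u , 1+u≡2^aq = u , (begin-equality
  2 * 2 ^ a * q           ≡⟨ *-assoc 2 (2 ^ a) q ⟩
  2 * (2 ^ a * q)         ≡⟨ cong (2 *_) 1+u≡2^aq ⟨
  2 * (1 + u)             ≡⟨ *-distribˡ-+ 2 1 u ⟩
  suc (suc (2 * u))       ∎)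

lemma4p1 : (k h : ℕ) → 2 ≤ h →
    (sumTo h (λ i → binomPred (2 ^ ⌊log₂ h ⌋ * (4 * k + 3) ∸ 1) i)) % 2 ≡ 0
    × (sumTo h (λ i → (2 ^ ⌊log₂ h ⌋ * (4 * k + 3)) C i)) % 4 ≡ 2
lemma4p1 k h 2≤h with 2^a*q≡2+2u ⌊log₂ h ⌋ (4 * k + 3) (⌊log₂⌋-mono-≤ 2≤h)
                        (≤-trans (s≤s z≤n) (m≤n+m 3 (4 * k)))
... | u , m≡2+2u =
  binomial-sums m u h m≡2+2u 2≤h (<-≤-trans h<2^[1+a] 2^[1+a]≤n) (nCj-twice-odd h 2^a≤h h<2^[1+a])
  where
  open BinomialRow ⌊log₂ h ⌋ k
  2^a≤h : 2 ^ ⌊log₂ h ⌋ ≤ h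
  2^a≤h = 2^⌊log₂n⌋≤n h {{>-nonZero (≤-trans (s≤s z≤n) 2≤h)}}
  h<2^[1+a] : h < 2 ^ suc ⌊log₂ h ⌋
  h<2^[1+a] = n<2^[1+⌊log₂n⌋] h
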